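{- Let $m,n$ be integers and let $(x,y,z,t)$ be integers with $m=x^{2}+y^{2}+z^{2}+t^{2}$ and $n=2x+3y+3z$. Suppose at least one of the following holds: $x-2y-2z+t\equiv0\pmod 5$; $x+2y-z+2t\equiv0\pmod 5$; $x-2y-2z-t\equiv0\pmod 5$; $x-y+2z-2t\equiv0\pmod 5$; $x+2y-z-2t\equiv0\pmod 5$; $x-y+2z+2t\equiv0\pmod 5$. Then there exist integers $x',y',z',t'$ with $m=x'^{2}+y'^{2}+z'^{2}+t'^{2}$ and $n=x'+y'+2z'+4t'$. -}

module Defs where

open import Data.Integer using (ℤ; _+_; _-_; _*_; +_)
open import Data.Integer.Divisibility using (_∣_)

sq : ℤ → ℤ
sq a = a * a

≡0mod5 : ℤ → Set
≡0mod5 a = (+ 5) ∣ a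

{-# OPTIONS --safe #-}
-- The vectors b = (2,3,3,0) and c = (1,1,2,4) both have norm 22. For each of the six congruences
-- there is an isometry g of ℚ⁴ with g b = c that maps v = (x,y,z,t) into ℤ⁴: the reflection in a⊥
-- for a vector a of norm 10 with a · v ≡ 0 (mod 5), followed by a signed permutation of the
-- coordinates. Then w = g v has w · w = v · v = m and c · w = g b · g v = b · v = n.
-- The symmetries t ↦ −t and y ↔ z fix b and split the six congruences into two orbits,
-- so two reflections suffice.
module Submission where

open import Defs
open import Data.Integer using (ℤ; _+_; _-_; _*_; +_; -_)
open import Data.Integer.Divisibility using (_∣_)
open import Data.Integer.Divisibility.Signed using (divides; ∣ᵤ⇒∣)
open import Data.Integer.Tactic.RingSolver using (solve-∀; solve)
open import Data.List using (_∷_; [])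
open import Data.Product using (∃-syntax; _×_; _,_)
open import Data.Sum using (_⊎_; inj₁; inj₂; [_,_])
open import Relation.Binary.PropositionalEquality
  using (_≡_; refl; sym; trans; cong; cong₂; subst; subst₂; module ≡-Reasoning)

ℤ⁴ : Set
ℤ⁴ = ℤ × ℤ × ℤ × ℤ

infix 7 _·_
_·_ : ℤ⁴ → ℤ⁴ → ℤ
(u₁ , u₂ , u₃ , u₄) · (v₁ , v₂ , v₃ , v₄) = u₁ * v₁ + u₂ * v₂ + u₃ * v₃ + u₄ * v₄

Isometry : (ℤ⁴ → ℤ⁴) → Set
Isometry σ = ∀ u v → σ u · σ v ≡ u · v

-- v − q a is the reflection of v in the hyperplane a⊥ exactly when 2 (a · v) = q (a · a).
reflect : ℤ⁴ → ℤ → ℤ⁴ → ℤ⁴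
reflect (a₁ , a₂ , a₃ , a₄) q (v₁ , v₂ , v₃ , v₄) =
  v₁ - q * a₁ , v₂ - q * a₂ , v₃ - q * a₃ , v₄ - q * a₄

reflect-·-reflect : ∀ a p u q v →
  reflect a p u · reflect a q v ≡ u · v - q * (a · u) - p * (a · v) + p * q * (a · a)
reflect-·-reflect (a₁ , a₂ , a₃ , a₄) p (u₁ , u₂ , u₃ , u₄) q (v₁ , v₂ , v₃ , v₄) =
  expand a₁ a₂ a₃ a₄ p u₁ u₂ u₃ u₄ q v₁ v₂ v₃ v₄
  where
  -- The ring solver does not unfold _·_ or reflect, so here and below the identities
  -- it proves are stated on coordinates.
  expand : ∀ a₁ a₂ a₃ a₄ p u₁ u₂ u₃ u₄ q v₁ v₂ v₃ v₄ →
    (u₁ - p * a₁) * (v₁ - q * a₁) + (u₂ - p * a₂) * (v₂ - q * a₂)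
      + (u₃ - p * a₃) * (v₃ - q * a₃) + (u₄ - p * a₄) * (v₄ - q * a₄)
    ≡ (u₁ * v₁ + u₂ * v₂ + u₃ * v₃ + u₄ * v₄)
      - q * (a₁ * u₁ + a₂ * u₂ + a₃ * u₃ + a₄ * u₄)
      - p * (a₁ * v₁ + a₂ * v₂ + a₃ * v₃ + a₄ * v₄)
      + p * q * (a₁ * a₁ + a₂ * a₂ + a₃ * a₃ + a₄ * a₄)
  expand = solve-∀

reflect-isometry : ∀ {k} a p u q v → a · a ≡ + 2 * k → a · u ≡ p * k → a · v ≡ q * k →
  reflect a p u · reflect a q v ≡ u · v
reflect-isometry {k} a p u q v a·a a·u a·v = begin
  reflect a p u · reflect a q v                         ≡⟨ reflect-·-reflect a p u q v ⟩
  u · v - q * (a · u) - p * (a · v) + p * q * (a · a)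
    ≡⟨ cong₂ (λ s r → u · v - q * s - p * r + p * q * (a · a)) a·u a·v ⟩
  u · v - q * (p * k) - p * (q * k) + p * q * (a · a)
    ≡⟨ cong (λ s → u · v - q * (p * k) - p * (q * k) + p * q * s) a·a ⟩
  u · v - q * (p * k) - p * (q * k) + p * q * (+ 2 * k) ≡⟨ cancel (u · v) p q k ⟩
  u · v                                                 ∎
  where
  open ≡-Reasoning
  cancel : ∀ w p q k → w - q * (p * k) - p * (q * k) + p * q * (+ 2 * k) ≡ w
  cancel = solve-∀

b c : ℤ⁴
b = + 2 , + 3 , + 3 , + 0
c = + 1 , + 1 , + 2 , + 4

Represented : ℤ → ℤ → Set
Represented m n = ∃[ w ] (m ≡ w · w × n ≡ c · w)

represented-by-reflection : ∀ k a p σ → Isometry σ →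
  a · a ≡ + 2 * k → a · b ≡ p * k → σ (reflect a p b) ≡ c →
  ∀ v → k ∣ a · v → Represented (v · v) (b · v)
represented-by-reflection k a p σ σ-isometry a·a a·b σb≡c v k∣a·v
  with ∣ᵤ⇒∣ {k} {a · v} k∣a·v
... | divides q a·v = σ (reflect a q v) , sym norm , sym form
  where
  open ≡-Reasoning
  norm : σ (reflect a q v) · σ (reflect a q v) ≡ v · v
  norm = trans (σ-isometry _ _) (reflect-isometry a q v q v a·a a·v a·v)
  form : c · σ (reflect a q v) ≡ b · v
  form = begin
    c · σ (reflect a q v)                 ≡⟨ cong (_· σ (reflect a q v)) (sym σb≡c) ⟩
    σ (reflect a p b) · σ (reflect a q v) ≡⟨ σ-isometry _ _ ⟩
    reflect a p b · reflect a q v         ≡⟨ reflect-isometry a p b q v a·a a·b a·v ⟩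
    b · v                                 ∎

represented-by-symmetry : ∀ τ → Isometry τ → τ b ≡ b →
  ∀ v → Represented (τ v · τ v) (b · τ v) → Represented (v · v) (b · v)
represented-by-symmetry τ τ-isometry τb≡b v =
  subst₂ Represented (τ-isometry v v) (trans (cong (_· τ v) (sym τb≡b)) (τ-isometry b v))

a₀ a₁ : ℤ⁴
a₀ = + 1 , - + 2 , - + 2 , + 1
a₁ = + 1 , + 2 , - + 1 , + 2

σ₀ σ₁ : ℤ⁴ → ℤ⁴
σ₀ (u₁ , u₂ , u₃ , u₄) = - u₂ , - u₃ , u₄ , u₁
σ₁ (u₁ , u₂ , u₃ , u₄) = u₂ , u₁ , - u₄ , u₃

σ₀-isometry : Isometry σ₀
σ₀-isometry (u₁ , u₂ , u₃ , u₄) (v₁ , v₂ , v₃ , v₄) = permute u₁ u₂ u₃ u₄ v₁ v₂ v₃ v₄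
  where
  permute : ∀ u₁ u₂ u₃ u₄ v₁ v₂ v₃ v₄ →
    - u₂ * - v₂ + - u₃ * - v₃ + u₄ * v₄ + u₁ * v₁ ≡ u₁ * v₁ + u₂ * v₂ + u₃ * v₃ + u₄ * v₄
  permute = solve-∀

σ₁-isometry : Isometry σ₁
σ₁-isometry (u₁ , u₂ , u₃ , u₄) (v₁ , v₂ , v₃ , v₄) = permute u₁ u₂ u₃ u₄ v₁ v₂ v₃ v₄
  where
  permute : ∀ u₁ u₂ u₃ u₄ v₁ v₂ v₃ v₄ →
    u₂ * v₂ + u₁ * v₁ + - u₄ * - v₄ + u₃ * v₃ ≡ u₁ * v₁ + u₂ * v₂ + u₃ * v₃ + u₄ * v₄
  permute = solve-∀

represented-by-a₀ : ∀ v → ≡0mod5 (a₀ · v) → Represented (v · v) (b · v)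
represented-by-a₀ = represented-by-reflection (+ 5) a₀ (- + 2) σ₀ σ₀-isometry refl refl refl

represented-by-a₁ : ∀ v → ≡0mod5 (a₁ · v) → Represented (v · v) (b · v)
represented-by-a₁ = represented-by-reflection (+ 5) a₁ (+ 1) σ₁ σ₁-isometry refl refl refl

negate-t swap-y-z : ℤ⁴ → ℤ⁴
negate-t (u₁ , u₂ , u₃ , u₄) = u₁ , u₂ , u₃ , - u₄
swap-y-z (u₁ , u₂ , u₃ , u₄) = u₁ , u₃ , u₂ , u₄

negate-t-isometry : Isometry negate-t
negate-t-isometry (u₁ , u₂ , u₃ , u₄) (v₁ , v₂ , v₃ , v₄) = permute u₁ u₂ u₃ u₄ v₁ v₂ v₃ v₄
  where
  permute : ∀ u₁ u₂ u₃ u₄ v₁ v₂ v₃ v₄ →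
    u₁ * v₁ + u₂ * v₂ + u₃ * v₃ + - u₄ * - v₄ ≡ u₁ * v₁ + u₂ * v₂ + u₃ * v₃ + u₄ * v₄
  permute = solve-∀

swap-y-z-isometry : Isometry swap-y-z
swap-y-z-isometry (u₁ , u₂ , u₃ , u₄) (v₁ , v₂ , v₃ , v₄) = permute u₁ u₂ u₃ u₄ v₁ v₂ v₃ v₄
  where
  permute : ∀ u₁ u₂ u₃ u₄ v₁ v₂ v₃ v₄ →
    u₁ * v₁ + u₃ * v₃ + u₂ * v₂ + u₄ * v₄ ≡ u₁ * v₁ + u₂ * v₂ + u₃ * v₃ + u₄ * v₄
  permute = solve-∀

represented-by-negate-t : ∀ v →
  Represented (negate-t v · negate-t v) (b · negate-t v) → Represented (v · v) (b · v)
represented-by-negate-t = represented-by-symmetry negate-t negate-t-isometry refl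

represented-by-swap-y-z : ∀ v →
  Represented (swap-y-z v · swap-y-z v) (b · swap-y-z v) → Represented (v · v) (b · v)
represented-by-swap-y-z = represented-by-symmetry swap-y-z swap-y-z-isometry refl

represented-if-a₀-orbit : ∀ x y z t →
  ≡0mod5 (x - + 2 * y - + 2 * z + t) ⊎ ≡0mod5 (x - + 2 * y - + 2 * z - t) →
  Represented (sq x + sq y + sq z + sq t) (b · (x , y , z , t))
represented-if-a₀-orbit x y z t =
  [ (λ 5∣ → represented-by-a₀ v (subst ≡0mod5 a₀·v 5∣))
  , (λ 5∣ → represented-by-negate-t v
              (represented-by-a₀ (negate-t v) (subst ≡0mod5 a₀·negate-t-v 5∣)))
  ]
  where
  v : ℤ⁴
  v = x , y , z , t
  a₀·v : x - + 2 * y - + 2 * z + t ≡ + 1 * x + - + 2 * y + - + 2 * z + + 1 * t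
  a₀·v = solve (x ∷ y ∷ z ∷ t ∷ [])
  a₀·negate-t-v : x - + 2 * y - + 2 * z - t ≡ + 1 * x + - + 2 * y + - + 2 * z + + 1 * - t
  a₀·negate-t-v = solve (x ∷ y ∷ z ∷ t ∷ [])

represented-if-a₁-orbit : ∀ x y z t →
  ≡0mod5 (x + + 2 * y - z + + 2 * t) ⊎ ≡0mod5 (x + + 2 * y - z - + 2 * t)
    ⊎ ≡0mod5 (x - y + + 2 * z + + 2 * t) ⊎ ≡0mod5 (x - y + + 2 * z - + 2 * t) →
  Represented (sq x + sq y + sq z + sq t) (b · (x , y , z , t))
represented-if-a₁-orbit x y z t =
  [ (λ 5∣ → represented-by-a₁ v (subst ≡0mod5 a₁·v 5∣))
  , [ (λ 5∣ → represented-by-negate-t v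
                (represented-by-a₁ (negate-t v) (subst ≡0mod5 a₁·negate-t-v 5∣)))
    , [ (λ 5∣ → represented-by-swap-y-z v
                  (represented-by-a₁ (swap-y-z v) (subst ≡0mod5 a₁·swap-y-z-v 5∣)))
      , (λ 5∣ → represented-by-swap-y-z v (represented-by-negate-t (swap-y-z v)
                  (represented-by-a₁ (negate-t (swap-y-z v)) (subst ≡0mod5 a₁·both-v 5∣))))
      ] ] ]
  where
  v : ℤ⁴
  v = x , y , z , t
  a₁·v : x + + 2 * y - z + + 2 * t ≡ + 1 * x + + 2 * y + - + 1 * z + + 2 * t
  a₁·v = solve (x ∷ y ∷ z ∷ t ∷ [])
  a₁·negate-t-v : x + + 2 * y - z - + 2 * t ≡ + 1 * x + + 2 * y + - + 1 * z + + 2 * - t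
  a₁·negate-t-v = solve (x ∷ y ∷ z ∷ t ∷ [])
  a₁·swap-y-z-v : x - y + + 2 * z + + 2 * t ≡ + 1 * x + + 2 * z + - + 1 * y + + 2 * t
  a₁·swap-y-z-v = solve (x ∷ y ∷ z ∷ t ∷ [])
  a₁·both-v : x - y + + 2 * z - + 2 * t ≡ + 1 * x + + 2 * z + - + 1 * y + + 2 * - t
  a₁·both-v = solve (x ∷ y ∷ z ∷ t ∷ [])

represented⇒∃ : ∀ x y z t →
  Represented (sq x + sq y + sq z + sq t) (b · (x , y , z , t)) →
  ∃[ x′ ] ∃[ y′ ] ∃[ z′ ] ∃[ t′ ]
    (sq x + sq y + sq z + sq t ≡ sq x′ + sq y′ + sq z′ + sq t′
      × + 2 * x + + 3 * y + + 3 * z ≡ x′ + y′ + + 2 * z′ + + 4 * t′)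
represented⇒∃ x y z t ((x′ , y′ , z′ , t′) , m≡ , n≡) =
  x′ , y′ , z′ , t′ , m≡ , trans b·v (trans n≡ c·w)
  where
  b·v : + 2 * x + + 3 * y + + 3 * z ≡ + 2 * x + + 3 * y + + 3 * z + + 0 * t
  b·v = solve (x ∷ y ∷ z ∷ t ∷ [])
  c·w : + 1 * x′ + + 1 * y′ + + 2 * z′ + + 4 * t′ ≡ x′ + y′ + + 2 * z′ + + 4 * t′
  c·w = solve (x′ ∷ y′ ∷ z′ ∷ t′ ∷ [])

lemma3p1 : (m n x y z t : ℤ) →
    m ≡ sq x + sq y + sq z + sq t →
    n ≡ + 2 * x + + 3 * y + + 3 * z →
    (≡0mod5 (x - + 2 * y - + 2 * z + t)
      ⊎ ≡0mod5 (x + + 2 * y - z + + 2 * t)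
      ⊎ ≡0mod5 (x - + 2 * y - + 2 * z - t)
      ⊎ ≡0mod5 (x - y + + 2 * z - + 2 * t)
      ⊎ ≡0mod5 (x + + 2 * y - z - + 2 * t)
      ⊎ ≡0mod5 (x - y + + 2 * z + + 2 * t)) →
    ∃[ x′ ] ∃[ y′ ] ∃[ z′ ] ∃[ t′ ]
      (m ≡ sq x′ + sq y′ + sq z′ + sq t′
        × n ≡ x′ + y′ + + 2 * z′ + + 4 * t′)
lemma3p1 _ _ x y z t refl refl (inj₁ 5∣) =
  represented⇒∃ x y z t (represented-if-a₀-orbit x y z t (inj₁ 5∣))
lemma3p1 _ _ x y z t refl refl (inj₂ (inj₁ 5∣)) =
  represented⇒∃ x y z t (represented-if-a₁-orbit x y z t (inj₁ 5∣))
lemma3p1 _ _ x y z t refl refl (inj₂ (inj₂ (inj₁ 5∣))) =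
  represented⇒∃ x y z t (represented-if-a₀-orbit x y z t (inj₂ 5∣))
lemma3p1 _ _ x y z t refl refl (inj₂ (inj₂ (inj₂ (inj₁ 5∣)))) =
  represented⇒∃ x y z t (represented-if-a₁-orbit x y z t (inj₂ (inj₂ (inj₂ 5∣))))
lemma3p1 _ _ x y z t refl refl (inj₂ (inj₂ (inj₂ (inj₂ (inj₁ 5∣))))) =
  represented⇒∃ x y z t (represented-if-a₁-orbit x y z t (inj₂ (inj₁ 5∣)))
lemma3p1 _ _ x y z t refl refl (inj₂ (inj₂ (inj₂ (inj₂ (inj₂ 5∣))))) =
  represented⇒∃ x y z t (represented-if-a₁-orbit x y z t (inj₂ (inj₂ (inj₁ 5∣))))
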